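{- Let $f:\mathbb{F}_2^n\to\mathbb{F}_2^n$ be a conjunctive Boolean network whose dependency graph has strongly connected components $G_1,\dots,G_t$, each containing at least one edge, and let $h$ be the conjunctive Boolean network whose dependency graph is the disjoint union of $G_1,\dots,G_t$ (i.e. the dependency graph of $f$ with all edges between distinct strongly connected components deleted). Then for every length $i$ the number of limit cycles of length $i$ of $f$ is at most the number of limit cycles of length $i$ of $h$; that is, $\mathcal{C}(f)\le\mathcal{C}(h)$ coefficientwise.
   Context: $\mathbb{F}_2=\{0,1\}$. A conjunctive Boolean network is a map $f=(f_1,\dots,f_n):\mathbb{F}_2^n\to\mathbb{F}_2^n$ where each $f_i$ is a product (AND) of a nonempty set of variables; its dependency graph has vertices $1,\dots,n$ and an edge $i\to j$ iff $x_i$ appears in $f_j$, and each directed graph with all in-degrees positive is the dependency graph of a unique conjunctive network. Strongly connected components are the subgraphs induced on classes of mutual reachability. A limit cycle of length $t$ is a set $\{\mathbf{u},\dots,f^{t-1}(\mathbf{u})\}$ with $f^t(\mathbf{u})=\mathbf{u}$, $t$ minimal. The cycle structure is $\mathcal{C}(f)=\sum_t C(f)_t\mathcal{C}_t$, $C(f)_t$ the number of limit cycles of length $t$. -}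

module Defs where

open import Data.Nat using (ℕ; zero; suc; _∸_)
open import Data.Nat.DivMod using (_/_)
open import Data.Bool using (Bool; true; false; _∧_; _∨_; not; _≟_)
open import Data.Fin using (Fin)
open import Data.Vec using (Vec; []; _∷_; tabulate; lookup)
open import Data.Vec.Properties using (≡-dec)
import Data.Bool.Properties as BP
open import Data.List using (List; []; _∷_; map; concatMap; filter; length; allFin; upTo; foldr)
open import Data.List using () renaming (_++_ to _++ₗ_)
open import Data.Product using (Σ; ∃; _×_; _,_)
open import Relation.Nullary.Decidable using (⌊_⌋)
open import Relation.Binary.PropositionalEquality using (_≡_)
open import Relation.Binary.Construct.Closure.ReflexiveTransitive using (Star)

-- A directed graph on vertices Fin n: G i j ≡ true iff there is an edge i → j.
Graph : ℕ → Set
Graph n = Fin n → Fin n → Bool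

Edge : ∀ {n} → Graph n → Fin n → Fin n → Set
Edge G i j = G i j ≡ true

PositiveInDegrees : ∀ {n} → Graph n → Set
PositiveInDegrees {n} G = ∀ (j : Fin n) → ∃ λ (i : Fin n) → Edge G i j

State : ℕ → Set
State n = Vec Bool n

-- The conjunctive network with dependency graph G:
-- f_j(x) = AND of x_i over all i with an edge i → j.
conj : ∀ {n} → Graph n → State n → State n
conj {n} G x = tabulate λ j →
  foldr (λ i b → (not (G i j) ∨ lookup x i) ∧ b) true (allFin n)

iter : ∀ {A : Set} → (A → A) → ℕ → A → A
iter f zero a = a
iter f (suc k) a = f (iter f k a)

allStates : (n : ℕ) → List (State n)
allStates zero = [] ∷ []
allStates (suc n) = map (false ∷_) (allStates n) ++ₗ map (true ∷_) (allStates n)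

_==_ : ∀ {n} → State n → State n → Bool
u == v = ⌊ ≡-dec BP._≟_ u v ⌋

-- u lies on a limit cycle of length exactly t (t ≥ 1):
-- f^t u = u and f^s u ≠ u for 1 ≤ s < t.
hasExactPeriod : ∀ {n} → (State n → State n) → ℕ → State n → Bool
hasExactPeriod f t u =
  (iter f t u == u) ∧ foldr (λ s b → not (iter f (suc s) u == u) ∧ b) true (upTo (t ∸ 1))

periodicPoints : ∀ {n} → (State n → State n) → ℕ → ℕ
periodicPoints {n} f t = length (filter (λ u → hasExactPeriod f t u ≟ true) (allStates n))

-- C(f)_t : the number of limit cycles of length t
-- (each limit cycle of length t consists of exactly t such states; no cycles of length 0)
numCycles : ∀ {n} → (State n → State n) → ℕ → ℕ
numCycles f zero = 0
numCycles f (suc k) = periodicPoints f (suc k) / suc k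

Reach : ∀ {n} → Graph n → Fin n → Fin n → Set
Reach G = Star (Edge G)

SameSCC : ∀ {n} → Graph n → Fin n → Fin n → Set
SameSCC G i j = Reach G i j × Reach G j i

EverySCCHasEdge : ∀ {n} → Graph n → Set
EverySCCHasEdge {n} G = ∀ (v : Fin n) → ∃ λ (u : Fin n) → ∃ λ (w : Fin n) →
  SameSCC G v u × SameSCC G v w × Edge G u w

IsSCCUnion : ∀ {n} → Graph n → Graph n → Set
IsSCCUnion {n} G H = ∀ (i j : Fin n) →
  (Edge H i j → Edge G i j × SameSCC G i j) × (Edge G i j × SameSCC G i j → Edge H i j)

{-# OPTIONS --safe #-}
-- On a limit cycle of the conjunctive network f of G, f and the network h of the
-- SCC-union H agree. An edge i → j only ever propagates a zero (x_i = 0 forces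
-- (f x)_j = 0), so a zero of f(x) at j, carried around a closed walk inside the SCC
-- of j whose length is a multiple of the period, comes back as a zero of x at the
-- last vertex d of that walk; d → j is an edge of H, hence h(x)_j = 0 as well.
-- So every orbit of f is an orbit of h with the same exact period, and f has at most
-- as many periodic points of each exact period as h.
module Submission where

open import Defs
open import Data.Nat using (ℕ; zero; suc; _+_; _*_; _∸_; _≤_; z≤n)
open import Data.Nat.Properties using (+-comm)
open import Data.Nat.Divisibility using (_∣_; divides; m∣m*n)
open import Data.Nat.DivMod using (/-monoˡ-≤)
open import Data.Bool using (Bool; true; false; _∧_; _∨_; not; _≟_)
open import Data.Bool.Properties using (∧-conicalˡ; ∧-conicalʳ; T-≡) renaming (_≟_ to _≟ᵇ_)
open import Data.Fin using (Fin)
open import Data.Vec using (lookup)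
open import Data.Vec.Properties using (lookup∘tabulate; ≡-dec)
open import Data.Vec.Relation.Binary.Pointwise.Inductive using (Pointwise-≡⇒≡)
open import Data.Vec.Relation.Binary.Pointwise.Extensional using (ext; extensional⇒inductive)
open import Data.List using ([]; _∷_; foldr; allFin; upTo)
open import Data.List.Properties using (foldr-cong)
open import Data.List.Relation.Unary.Any using (here; there)
open import Data.List.Membership.Propositional using (_∈_)
open import Data.List.Membership.Propositional.Properties using (∈-allFin)
open import Data.List.Relation.Binary.Sublist.Propositional.Properties
  using (filter⁺; length-mono-≤)
open import Data.List.Relation.Binary.Sublist.Propositional using (⊆-refl)
open import Data.Product using (∃; _×_; _,_; proj₁; proj₂)
open import Function.Bundles using (Equivalence)
open import Relation.Nullary.Decidable using (toWitness)
open import Relation.Binary.PropositionalEquality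
open import Relation.Binary.Construct.Closure.ReflexiveTransitive using (Star; ε; _◅_; _◅◅_)

private
  variable
    A : Set
    n : ℕ
    G H : Graph n

module _ (f : A → A) where

  iter-+ : ∀ m k x → iter f (m + k) x ≡ iter f m (iter f k x)
  iter-+ zero    k x = refl
  iter-+ (suc m) k x = cong f (iter-+ m k x)

  iter-suc : ∀ m x → iter f (suc m) x ≡ iter f m (f x)
  iter-suc zero    x = refl
  iter-suc (suc m) x = cong f (iter-suc m x)

  iter-fixed-multiple : ∀ {p m x} → iter f p x ≡ x → p ∣ m → iter f m x ≡ x
  iter-fixed-multiple {p} {x = x} fix (divides k refl) = go k
    where
    go : ∀ k → iter f (k * p) x ≡ x
    go zero    = refl
    go (suc k) = trans (iter-+ p (k * p) x) (trans (cong (iter f p) (go k)) fix)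

Periodic : (A → A) → A → Set
Periodic f x = ∃ λ q → iter f (suc q) x ≡ x

periodic-orbit : ∀ (f : A → A) {x} → Periodic f x → ∀ s → Periodic f (iter f s x)
periodic-orbit f {x} (q , fix) s = q , (begin
  iter f (suc q) (iter f s x) ≡⟨ sym (iter-+ f (suc q) s x) ⟩
  iter f (suc q + s) x        ≡⟨ cong (λ m → iter f m x) (+-comm (suc q) s) ⟩
  iter f (s + suc q) x        ≡⟨ iter-+ f s (suc q) x ⟩
  iter f s (iter f (suc q) x) ≡⟨ cong (iter f s) fix ⟩
  iter f s x                  ∎)
  where open ≡-Reasoning

foldr-∧-true⇒ : ∀ (P : A → Bool) xs → foldr (λ a b → P a ∧ b) true xs ≡ true →
                ∀ {a} → a ∈ xs → P a ≡ true
foldr-∧-true⇒ P (x ∷ xs) holds (here refl)  = ∧-conicalˡ (P x) _ holds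
foldr-∧-true⇒ P (x ∷ xs) holds (there a∈xs) = foldr-∧-true⇒ P xs (∧-conicalʳ (P x) _ holds) a∈xs

foldr-∧-true⇐ : ∀ (P : A → Bool) xs → (∀ {a} → a ∈ xs → P a ≡ true) →
                foldr (λ a b → P a ∧ b) true xs ≡ true
foldr-∧-true⇐ P []       holds = refl
foldr-∧-true⇐ P (x ∷ xs) holds =
  cong₂ _∧_ (holds (here refl)) (foldr-∧-true⇐ P xs (λ a∈xs → holds (there a∈xs)))

not-∨-true⇒ : ∀ {a b} → not a ∨ b ≡ true → a ≡ true → b ≡ true
not-∨-true⇒ p refl = p

not-∨-true⇐ : ∀ a {b} → (a ≡ true → b ≡ true) → not a ∨ b ≡ true
not-∨-true⇐ false imp = refl
not-∨-true⇐ true  imp = imp refl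

lookup-conj : ∀ (G : Graph n) x j →
  lookup (conj G x) j ≡ foldr (λ i b → (not (G i j) ∨ lookup x i) ∧ b) true (allFin n)
lookup-conj G x j = lookup∘tabulate _ j

conj-true⇒ : ∀ {x : State n} {i j} → lookup (conj G x) j ≡ true → Edge G i j → lookup x i ≡ true
conj-true⇒ {G = G} {x} {i} {j} fj e = not-∨-true⇒
  (foldr-∧-true⇒ (λ i → not (G i j) ∨ lookup x i) (allFin _)
    (trans (sym (lookup-conj G x j)) fj) (∈-allFin i))
  e

conj-true⇐ : ∀ {x : State n} {j} → (∀ i → Edge G i j → lookup x i ≡ true) →
  lookup (conj G x) j ≡ true
conj-true⇐ {G = G} {x} {j} inputs = trans (lookup-conj G x j)
  (foldr-∧-true⇐ (λ i → not (G i j) ∨ lookup x i) (allFin _)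
    λ {i} _ → not-∨-true⇐ (G i j) (inputs i))

conj-false : ∀ {x : State n} {i j} → Edge G i j → lookup x i ≡ false → lookup (conj G x) j ≡ false
conj-false {G = G} {x} {j = j} e xi with lookup (conj G x) j in fj
... | false = refl
... | true  with trans (sym xi) (conj-true⇒ {G = G} {x = x} fj e)
...   | ()

data Walk (G : Graph n) : Fin n → Fin n → ℕ → Set where
  []  : ∀ {a} → Walk G a a 0
  _∷_ : ∀ {a b c L} → Edge G a b → Walk G b c L → Walk G a c (suc L)

_++ʷ_ : ∀ {a b c L M} → Walk G a b L → Walk G b c M → Walk G a c (L + M)
[]       ++ʷ v = v
(e ∷ w) ++ʷ v = e ∷ (w ++ʷ v)

repeatʷ : ∀ {a L} → Walk G a a L → ∀ k → Walk G a a (k * L)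
repeatʷ c zero    = []
repeatʷ c (suc k) = c ++ʷ repeatʷ c k

reach⇒walk : ∀ {a b} → Reach G a b → ∃ (Walk G a b)
reach⇒walk ε       = 0 , []
reach⇒walk (e ◅ r) with reach⇒walk r
... | L , w = suc L , e ∷ w

star-last : ∀ {R : A → A → Set} {a b c} → R a b → Star R b c → ∃ λ d → Star R a d × R d c
star-last {a = a} r ε = a , ε , r
star-last r (r′ ◅ rs) with star-last r′ rs
... | d , path , last = d , r ◅ path , last

scc-predecessor : EverySCCHasEdge G → ∀ j → ∃ λ d → Reach G j d × Edge G d j
scc-predecessor sccs j with sccs j
... | u , w , (j⇝u , _) , (_ , w⇝j) , u→w with star-last u→w w⇝j
...   | d , u⇝d , d→j = d , j⇝u ◅◅ u⇝d , d→j

conj-false-along : ∀ {a b L} → Walk G a b L → (x : State n) →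
  lookup x a ≡ false → lookup (iter (conj G) L x) b ≡ false
conj-false-along [] x xa = xa
conj-false-along {G = G} {b = b} {L = suc L} (e ∷ w) x xa =
  subst (λ y → lookup y b ≡ false) (sym (iter-suc (conj G) L x))
    (conj-false-along {G = G} w (conj G x) (conj-false {G = G} {x = x} e xa))

-- The zero of f(x) at j is carried along w to d and then q times around the cycle
-- d → j ⇝ d; after suc q * suc L steps of f from x, a multiple of the period, it is
-- a zero of x itself.
periodic-false-has-scc-input : EverySCCHasEdge G → ∀ {x : State n} {j} → Periodic (conj G) x →
  lookup (conj G x) j ≡ false → ∃ λ d → Edge G d j × SameSCC G d j × lookup x d ≡ false
periodic-false-has-scc-input {G = G} sccs {x} {j} (q , fix) fj with scc-predecessor sccs j
... | d , j⇝d , d→j with reach⇒walk j⇝d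
...   | L , w = d , d→j , (d→j ◅ ε , j⇝d) ,
                subst (λ y → lookup y d ≡ false) returns (conj-false-along pumped (conj G x) fj)
  where
  pumped : Walk G j d (L + q * suc L)
  pumped = w ++ʷ repeatʷ (d→j ∷ w) q

  returns : iter (conj G) (L + q * suc L) (conj G x) ≡ x
  returns = trans (sym (iter-suc (conj G) (L + q * suc L) x))
                  (iter-fixed-multiple (conj G) fix (m∣m*n {suc q} (suc L)))

conj-agrees-on-periodic : EverySCCHasEdge G → IsSCCUnion G H →
  ∀ {x} → Periodic (conj G) x → conj G x ≡ conj H x
conj-agrees-on-periodic {G = G} {H = H} sccs union {x} per =
  Pointwise-≡⇒≡ (extensional⇒inductive (ext coordinate))
  where
  coordinate : ∀ j → lookup (conj G x) j ≡ lookup (conj H x) j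
  coordinate j with lookup (conj G x) j in fj
  ... | true  = sym (conj-true⇐ {G = H} {x = x} λ i i→j →
                conj-true⇒ {G = G} {x = x} fj (proj₁ (proj₁ (union i j) i→j)))
  ... | false with periodic-false-has-scc-input sccs per fj
  ...   | d , d→j , d~j , xd = sym (conj-false {G = H} {x = x} (proj₂ (union d j) (d→j , d~j)) xd)

orbits-agree : EverySCCHasEdge G → IsSCCUnion G H →
  ∀ {u} → Periodic (conj G) u → ∀ s → iter (conj G) s u ≡ iter (conj H) s u
orbits-agree sccs union per zero = refl
orbits-agree {G = G} {H = H} sccs union per (suc s) =
  trans (conj-agrees-on-periodic sccs union (periodic-orbit (conj G) per s))
        (cong (conj H) (orbits-agree sccs union per s))

==-sound : ∀ {u v : State n} → u == v ≡ true → u ≡ v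
==-sound {u = u} {v} eq = toWitness {a? = ≡-dec _≟ᵇ_ u v} (Equivalence.from T-≡ eq)

exactPeriod⇒periodic : ∀ (f : State n → State n) {u} k →
  hasExactPeriod f (suc k) u ≡ true → Periodic f u
exactPeriod⇒periodic f k exact = k , ==-sound (∧-conicalˡ _ _ exact)

hasExactPeriod-cong : ∀ (f g : State n → State n) {u} → (∀ s → iter f s u ≡ iter g s u) →
  ∀ t → hasExactPeriod f t u ≡ hasExactPeriod g t u
hasExactPeriod-cong f g {u} same t = cong₂ _∧_ (cong (_== u) (same t))
  (foldr-cong (λ s b → cong (λ v → not (v == u) ∧ b) (same (suc s))) refl (upTo (t ∸ 1)))

exactPeriod-transfer : EverySCCHasEdge G → IsSCCUnion G H → ∀ k u →
  hasExactPeriod (conj G) (suc k) u ≡ true → hasExactPeriod (conj H) (suc k) u ≡ true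
exactPeriod-transfer {G = G} {H = H} sccs union k u exact =
  trans (sym (hasExactPeriod-cong (conj G) (conj H)
                (orbits-agree sccs union (exactPeriod⇒periodic (conj G) k exact)) (suc k)))
        exact

periodicPoints-mono : ∀ {n} (f g : State n → State n) t →
  (∀ u → hasExactPeriod f t u ≡ true → hasExactPeriod g t u ≡ true) →
  periodicPoints f t ≤ periodicPoints g t
periodicPoints-mono {n} f g t f⇒g = length-mono-≤
  (filter⁺ (λ u → hasExactPeriod f t u ≟ true) (λ u → hasExactPeriod g t u ≟ true)
           (λ { refl → f⇒g _ }) (⊆-refl {x = allStates n}))

mainTheorem13 : ∀ (n : ℕ) (G H : Graph n) →
    PositiveInDegrees G → EverySCCHasEdge G → IsSCCUnion G H →
    ∀ (i : ℕ) → numCycles (conj G) i ≤ numCycles (conj H) i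
mainTheorem13 n G H _ sccs union zero    = z≤n
mainTheorem13 n G H _ sccs union (suc k) = /-monoˡ-≤ (suc k)
  (periodicPoints-mono (conj G) (conj H) (suc k)
    (exactPeriod-transfer {G = G} {H = H} sccs union k))
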